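{- If $X,Y\subseteq B^n$ and $X$ subsumes $Y$, then $s(X)\le s(Y)$.
   Context: $B=\{0,1\}$. A comparator $[i,j]$ replaces $x_i$ by $\min(x_i,x_j)$ and $x_j$ by $\max(x_i,x_j)$; an exchange $(i,j)$ swaps entries $i,j$. A comparator network on $n$ channels is a finite sequence of comparators and exchanges applied left to right; its size is its number of comparators. For $X\subseteq B^n$, $s(X)$ is the minimal size of a comparator network whose output on every $x\in X$ is sorted (nondecreasing). A permutation $\sigma$ of $\{1,\dots,n\}$ acts by $(x^\sigma)_{\sigma(i)}=x_i$; $x^{\mathbf b}$ is elementwise Boolean negation; these act on sets elementwise. Similarity $\sim$ is the equivalence relation on subsets of $B^n$ generated by $X\sim Y^\sigma$ (permutations) and $X\sim X^{\mathbf b}$. Subsumption is the preorder generated by inclusion $\subseteq$ and similarity; equivalently, $X$ subsumes $Y$ iff there is $T$ with $X\sim T\subseteq Y$. -}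

module Defs where

open import Data.Nat using (ℕ; zero; suc; _+_)
import Data.Nat as ℕ
open import Data.Bool using (Bool; true; false; not; _∧_; _∨_)
import Data.Bool as 𝔹
open import Data.Fin using (Fin; toℕ)
import Data.Fin as F
open import Data.Fin.Permutation using (Permutation′; _⟨$⟩ˡ_)
open import Data.Vec using (Vec; lookup; tabulate; map; _[_]≔_)
open import Data.List using (List; []; _∷_)
open import Data.Product using (Σ; ∃; _×_; _,_)
open import Relation.Binary.PropositionalEquality using (_≡_)
open import Level using (0ℓ)

Bn : ℕ → Set
Bn n = Vec Bool n

SetB : ℕ → Set₁
SetB n = Bn n → Set

_⊆B_ : ∀ {n} → SetB n → SetB n → Set
X ⊆B Y = ∀ x → X x → Y x

_≐B_ : ∀ {n} → SetB n → SetB n → Set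
X ≐B Y = (X ⊆B Y) × (Y ⊆B X)

data Gate (n : ℕ) : Set where
  comp : (i j : Fin n) → toℕ i ℕ.< toℕ j → Gate n
  exch : (i j : Fin n) → Gate n

Network : ℕ → Set
Network n = List (Gate n)

applyGate : ∀ {n} → Gate n → Bn n → Bn n
applyGate (comp i j _) x =
  (x [ i ]≔ (lookup x i ∧ lookup x j)) [ j ]≔ (lookup x i ∨ lookup x j)
applyGate (exch i j) x = (x [ i ]≔ lookup x j) [ j ]≔ lookup x i

run : ∀ {n} → Network n → Bn n → Bn n
run [] x = x
run (g ∷ gs) x = run gs (applyGate g x)

size : ∀ {n} → Network n → ℕ
size [] = 0
size (comp _ _ _ ∷ gs) = suc (size gs)
size (exch _ _ ∷ gs) = size gs

Sorted : ∀ {n} → Bn n → Set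
Sorted {n} x = ∀ (i j : Fin n) → toℕ i ℕ.≤ toℕ j → lookup x i 𝔹.≤ lookup x j

Sorts : ∀ {n} → Network n → SetB n → Set
Sorts C X = ∀ x → X x → Sorted (run C x)

-- "k = s(X)": k is the minimal size of a network sorting X
IsS : ∀ {n} → SetB n → ℕ → Set
IsS {n} X k = (Σ (Network n) λ C → Sorts C X × size C ≡ k)
            × (∀ (C : Network n) → Sorts C X → k ℕ.≤ size C)

-- permutation action: (x^σ)_{σ(i)} = x_i, i.e. (x^σ)_j = x_{σ⁻¹(j)}
permVec : ∀ {n} → Permutation′ n → Bn n → Bn n
permVec σ x = tabulate (λ j → lookup x (σ ⟨$⟩ˡ j))

permSet : ∀ {n} → Permutation′ n → SetB n → SetB n
permSet {n} σ X y = Σ (Bn n) λ x → X x × (y ≡ permVec σ x)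

negVec : ∀ {n} → Bn n → Bn n
negVec = map not

negSet : ∀ {n} → SetB n → SetB n
negSet {n} X y = Σ (Bn n) λ x → X x × (y ≡ negVec x)

-- similarity: equivalence relation generated by X ~ X^σ and X ~ X^b
-- (sets are predicates, so set equality is extensional ≐B)
data Similar {n : ℕ} : SetB n → SetB n → Set₁ where
  sim-eq    : ∀ {X Y} → X ≐B Y → Similar X Y
  sim-perm  : ∀ {X} (σ : Permutation′ n) → Similar X (permSet σ X)
  sim-neg   : ∀ {X} → Similar X (negSet X)
  sim-sym   : ∀ {X Y} → Similar X Y → Similar Y X
  sim-trans : ∀ {X Y Z} → Similar X Y → Similar Y Z → Similar X Z

data Subsumes {n : ℕ} : SetB n → SetB n → Set₁ where
  sub-incl  : ∀ {X Y} → X ⊆B Y → Subsumes X Y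
  sub-sim   : ∀ {X Y} → Similar X Y → Subsumes X Y
  sub-trans : ∀ {X Y Z} → Subsumes X Y → Subsumes Y Z → Subsumes X Z

-- Sorting X is never harder than sorting Y when X ⊆ Y, so it suffices to show that
-- similar sets are equally hard to sort.  A permutation of the channels is realised by
-- a network of exchanges, which costs nothing; prepending it turns a network sorting
-- X^σ into one sorting X, and vice versa.  For negation, running a network on x^b
-- yields (run C x)^b provided every comparator is followed by an exchange of its two
-- channels (¬ min = max ¬); the result is sorted in reverse, which a final reversal,
-- again a network of exchanges, corrects.
module Submission where

open import Defs
open import Data.Nat using (ℕ; suc; _+_; _≤_; s≤s)
open import Data.Nat.Properties using (≤-refl; ≤-trans; ≤-reflexive; ∸-monoʳ-≤; +-identityʳ)
open import Data.Bool using (not; _∧_; _∨_)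
import Data.Bool as 𝔹
open import Data.Bool.Properties using (not-involutive; ∨-∧-booleanAlgebra)
open import Algebra.Lattice.Properties.BooleanAlgebra ∨-∧-booleanAlgebra using (deMorgan₁; deMorgan₂)
open import Data.Fin using (Fin; toℕ; _≟_; _<_; opposite)
open import Data.Fin.Properties using (<⇒≢; opposite-prop)
open import Data.Fin.Permutation using (Permutation′; _⟨$⟩ʳ_; _⟨$⟩ˡ_; inverseˡ; flip; reverse)
open import Data.Fin.Permutation.Components using (transpose)
open import Data.Fin.Permutation.Transposition.List using (TranspositionList; eval; decompose; eval-decompose)
open import Data.Vec using (Vec; lookup; _[_]≔_)
open import Data.Vec.Properties using (lookup∘update; lookup∘update′; lookup-map; lookup∘tabulate)
open import Data.Vec.Relation.Binary.Pointwise.Extensional using (ext; Pointwise-≡⇒≡)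
open import Data.List using ([]; _∷_; _++_)
open import Data.Product using (Σ; _×_; _,_; proj₁)
open import Relation.Binary.PropositionalEquality
open import Relation.Nullary using (yes; no; contradiction)

run-++ : ∀ {n} (C D : Network n) x → run (C ++ D) x ≡ run D (run C x)
run-++ []      D x = refl
run-++ (g ∷ C) D x = run-++ C D (applyGate g x)

size-++ : ∀ {n} (C D : Network n) → size (C ++ D) ≡ size C + size D
size-++ []               D = refl
size-++ (comp _ _ _ ∷ C) D = cong suc (size-++ C D)
size-++ (exch _ _ ∷ C)   D = size-++ C D

module _ {n} {A : Set} (x : Vec A n) {i j : Fin n} (a b : A) where

  lookup-update²-second : lookup ((x [ i ]≔ a) [ j ]≔ b) j ≡ b
  lookup-update²-second = lookup∘update j (x [ i ]≔ a) b

  lookup-update²-first : i ≢ j → lookup ((x [ i ]≔ a) [ j ]≔ b) i ≡ a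
  lookup-update²-first i≢j = trans (lookup∘update′ i≢j (x [ i ]≔ a) b) (lookup∘update i x a)

  lookup-update²-other : ∀ {k} → k ≢ i → k ≢ j → lookup ((x [ i ]≔ a) [ j ]≔ b) k ≡ lookup x k
  lookup-update²-other k≢i k≢j = trans (lookup∘update′ k≢j (x [ i ]≔ a) b) (lookup∘update′ k≢i x a)

lookup-exch : ∀ {n} (x : Bn n) i j k → lookup (applyGate (exch i j) x) k ≡ lookup x (transpose i j k)
lookup-exch x i j k with k ≟ i
lookup-exch x i j k | yes refl with k ≟ j
... | yes refl = lookup-update²-second x _ _
... | no k≢j   = lookup-update²-first x _ _ k≢j
lookup-exch x i j k | no k≢i with k ≟ j
... | yes refl = lookup-update²-second x _ _
... | no k≢j   = lookup-update²-other x _ _ k≢i k≢j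

exchangeNetwork : ∀ {n} → TranspositionList n → Network n
exchangeNetwork []             = []
exchangeNetwork ((i , j) ∷ ts) = exchangeNetwork ts ++ exch i j ∷ []

size-exchangeNetwork : ∀ {n} (ts : TranspositionList n) → size (exchangeNetwork ts) ≡ 0
size-exchangeNetwork []             = refl
size-exchangeNetwork ((i , j) ∷ ts) = begin
  size (exchangeNetwork ts ++ exch i j ∷ []) ≡⟨ size-++ (exchangeNetwork ts) _ ⟩
  size (exchangeNetwork ts) + 0              ≡⟨ +-identityʳ _ ⟩
  size (exchangeNetwork ts)                  ≡⟨ size-exchangeNetwork ts ⟩
  0                                          ∎
  where open ≡-Reasoning

lookup-run-exchangeNetwork : ∀ {n} (ts : TranspositionList n) x k →
  lookup (run (exchangeNetwork ts) x) k ≡ lookup x (eval ts ⟨$⟩ʳ k)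
lookup-run-exchangeNetwork []             x k = refl
lookup-run-exchangeNetwork ((i , j) ∷ ts) x k = begin
  lookup (run (exchangeNetwork ts ++ exch i j ∷ []) x) k       ≡⟨ cong (λ v → lookup v k) (run-++ (exchangeNetwork ts) _ x) ⟩
  lookup (applyGate (exch i j) (run (exchangeNetwork ts) x)) k ≡⟨ lookup-exch (run (exchangeNetwork ts) x) i j k ⟩
  lookup (run (exchangeNetwork ts) x) (transpose i j k)        ≡⟨ lookup-run-exchangeNetwork ts x _ ⟩
  lookup x (eval ts ⟨$⟩ʳ transpose i j k)                      ∎
  where open ≡-Reasoning

permutationNetwork : ∀ {n} → Permutation′ n → Network n
permutationNetwork π = exchangeNetwork (decompose π)

size-permutationNetwork : ∀ {n} (π : Permutation′ n) → size (permutationNetwork π) ≡ 0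
size-permutationNetwork π = size-exchangeNetwork (decompose π)

lookup-run-permutationNetwork : ∀ {n} (π : Permutation′ n) x k →
  lookup (run (permutationNetwork π) x) k ≡ lookup x (π ⟨$⟩ʳ k)
lookup-run-permutationNetwork π x k =
  trans (lookup-run-exchangeNetwork (decompose π) x k) (cong (lookup x) (eval-decompose π k))

run-permutationNetwork-flip : ∀ {n} (σ : Permutation′ n) x →
  run (permutationNetwork (flip σ)) x ≡ permVec σ x
run-permutationNetwork-flip σ x = Pointwise-≡⇒≡ (ext λ k →
  trans (lookup-run-permutationNetwork (flip σ) x k) (sym (lookup∘tabulate _ k)))

permVec-flip-permVec : ∀ {n} (σ : Permutation′ n) x → permVec (flip σ) (permVec σ x) ≡ x
permVec-flip-permVec σ x = Pointwise-≡⇒≡ (ext λ k →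
  trans (lookup∘tabulate _ k) (trans (lookup∘tabulate (λ j → lookup x (σ ⟨$⟩ˡ j)) (σ ⟨$⟩ʳ k))
    (cong (lookup x) (inverseˡ σ))))

lookup-negVec : ∀ {n} (x : Bn n) k → lookup (negVec x) k ≡ not (lookup x k)
lookup-negVec x k = lookup-map k not x

negVec-involutive : ∀ {n} (x : Bn n) → negVec (negVec x) ≡ x
negVec-involutive x = Pointwise-≡⇒≡ (ext λ k →
  trans (lookup-negVec (negVec x) k) (trans (cong not (lookup-negVec x k)) (not-involutive _)))

exch-negVec : ∀ {n} (x : Bn n) i j → applyGate (exch i j) (negVec x) ≡ negVec (applyGate (exch i j) x)
exch-negVec x i j = Pointwise-≡⇒≡ (ext λ k → begin
  lookup (applyGate (exch i j) (negVec x)) k ≡⟨ lookup-exch (negVec x) i j k ⟩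
  lookup (negVec x) (transpose i j k)        ≡⟨ lookup-negVec x _ ⟩
  not (lookup x (transpose i j k))           ≡⟨ cong not (lookup-exch x i j k) ⟨
  not (lookup (applyGate (exch i j) x) k)    ≡⟨ lookup-negVec (applyGate (exch i j) x) k ⟨
  lookup (negVec (applyGate (exch i j) x)) k ∎)
  where open ≡-Reasoning

exch-comp-negVec : ∀ {n} (x : Bn n) i j (i<j : i < j) →
  applyGate (exch i j) (applyGate (comp i j i<j) (negVec x)) ≡ negVec (applyGate (comp i j i<j) x)
exch-comp-negVec x i j i<j = Pointwise-≡⇒≡ (ext λ k → trans (entry k) (sym (lookup-negVec cx k)))
  where
  open ≡-Reasoning
  i≢j = <⇒≢ i<j
  ¬x = negVec x
  cx = applyGate (comp i j i<j) x
  c¬x = applyGate (comp i j i<j) ¬x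
  entry : ∀ k → lookup (applyGate (exch i j) c¬x) k ≡ not (lookup cx k)
  entry k with k ≟ i | k ≟ j
  ... | yes refl | yes refl = contradiction refl i≢j
  ... | yes refl | no _ = begin
    lookup (applyGate (exch k j) c¬x) k     ≡⟨ lookup-update²-first c¬x _ _ i≢j ⟩
    lookup c¬x j                            ≡⟨ lookup-update²-second ¬x _ _ ⟩
    lookup ¬x k ∨ lookup ¬x j               ≡⟨ cong₂ _∨_ (lookup-negVec x k) (lookup-negVec x j) ⟩
    not (lookup x k) ∨ not (lookup x j)     ≡⟨ deMorgan₁ (lookup x k) (lookup x j) ⟨
    not (lookup x k ∧ lookup x j)           ≡⟨ cong not (lookup-update²-first x _ _ i≢j) ⟨
    not (lookup cx k)                       ∎
  ... | no _ | yes refl = begin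
    lookup (applyGate (exch i k) c¬x) k     ≡⟨ lookup-update²-second c¬x _ _ ⟩
    lookup c¬x i                            ≡⟨ lookup-update²-first ¬x _ _ i≢j ⟩
    lookup ¬x i ∧ lookup ¬x k               ≡⟨ cong₂ _∧_ (lookup-negVec x i) (lookup-negVec x k) ⟩
    not (lookup x i) ∧ not (lookup x k)     ≡⟨ deMorgan₂ (lookup x i) (lookup x k) ⟨
    not (lookup x i ∨ lookup x k)           ≡⟨ cong not (lookup-update²-second x _ _) ⟨
    not (lookup cx k)                       ∎
  ... | no k≢i | no k≢j = begin
    lookup (applyGate (exch i j) c¬x) k     ≡⟨ lookup-update²-other c¬x _ _ k≢i k≢j ⟩
    lookup c¬x k                            ≡⟨ lookup-update²-other ¬x _ _ k≢i k≢j ⟩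
    lookup ¬x k                             ≡⟨ lookup-negVec x k ⟩
    not (lookup x k)                        ≡⟨ cong not (lookup-update²-other x _ _ k≢i k≢j) ⟨
    not (lookup cx k)                       ∎

dualNetwork : ∀ {n} → Network n → Network n
dualNetwork []                 = []
dualNetwork (comp i j i<j ∷ C) = comp i j i<j ∷ exch i j ∷ dualNetwork C
dualNetwork (exch i j ∷ C)     = exch i j ∷ dualNetwork C

size-dualNetwork : ∀ {n} (C : Network n) → size (dualNetwork C) ≡ size C
size-dualNetwork []               = refl
size-dualNetwork (comp _ _ _ ∷ C) = cong suc (size-dualNetwork C)
size-dualNetwork (exch _ _ ∷ C)   = size-dualNetwork C

run-dualNetwork : ∀ {n} (C : Network n) x → run (dualNetwork C) (negVec x) ≡ negVec (run C x)
run-dualNetwork []                 x = refl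
run-dualNetwork (comp i j i<j ∷ C) x =
  trans (cong (run (dualNetwork C)) (exch-comp-negVec x i j i<j)) (run-dualNetwork C _)
run-dualNetwork (exch i j ∷ C)     x =
  trans (cong (run (dualNetwork C)) (exch-negVec x i j)) (run-dualNetwork C _)

opposite-antitone : ∀ {n} {i j : Fin n} → toℕ i ≤ toℕ j → toℕ (opposite j) ≤ toℕ (opposite i)
opposite-antitone {n} {i} {j} i≤j rewrite opposite-prop i | opposite-prop j = ∸-monoʳ-≤ n (s≤s i≤j)

not-antitone : ∀ {a b} → a 𝔹.≤ b → not b 𝔹.≤ not a
not-antitone 𝔹.f≤t = 𝔹.f≤t
not-antitone 𝔹.b≤b = 𝔹.b≤b

Sorted-reverse-negVec : ∀ {n} {u : Bn n} → Sorted u → Sorted (run (permutationNetwork reverse) (negVec u))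
Sorted-reverse-negVec {u = u} u↑ i j i≤j =
  subst₂ 𝔹._≤_ (sym (entry i)) (sym (entry j)) (not-antitone (u↑ _ _ (opposite-antitone i≤j)))
  where
  entry : ∀ k → lookup (run (permutationNetwork reverse) (negVec u)) k ≡ not (lookup u (opposite k))
  entry k = trans (lookup-run-permutationNetwork reverse (negVec u) k) (lookup-negVec u (opposite k))

NoHarderToSort : ∀ {n} → SetB n → SetB n → Set
NoHarderToSort {n} X Y =
  ∀ (C : Network n) → Sorts C Y → Σ (Network n) λ C′ → Sorts C′ X × size C′ ≤ size C

module _ {n : ℕ} where

  noHarderToSort-⊆ : {X Y : SetB n} → X ⊆B Y → NoHarderToSort X Y
  noHarderToSort-⊆ X⊆Y C C↑ = C , (λ x Xx → C↑ x (X⊆Y x Xx)) , ≤-refl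

  noHarderToSort-trans : {X Y Z : SetB n} → NoHarderToSort X Y → NoHarderToSort Y Z → NoHarderToSort X Z
  noHarderToSort-trans X≼Y Y≼Z C C↑ with Y≼Z C C↑
  ... | D , D↑ , D≤C with X≼Y D D↑
  ...   | E , E↑ , E≤D = E , E↑ , ≤-trans E≤D D≤C

  noHarderToSort-permVec : {X Y : SetB n} (σ : Permutation′ n) →
    (∀ x → X x → Y (permVec σ x)) → NoHarderToSort X Y
  noHarderToSort-permVec σ X→Y C C↑ =
    P ++ C , P++C↑ , ≤-reflexive (trans (size-++ P C) (cong (_+ size C) (size-permutationNetwork (flip σ))))
    where
    P = permutationNetwork (flip σ)
    P++C↑ : Sorts (P ++ C) _
    P++C↑ x Xx rewrite run-++ P C x | run-permutationNetwork-flip σ x = C↑ _ (X→Y x Xx)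

  noHarderToSort-negVec : {X Y : SetB n} → (∀ x → X x → Y (negVec x)) → NoHarderToSort X Y
  noHarderToSort-negVec X→Y C C↑ = D ++ R , D++R↑ , ≤-reflexive size-D++R
    where
    D = dualNetwork C
    R = permutationNetwork reverse
    size-D++R : size (D ++ R) ≡ size C
    size-D++R rewrite size-++ D R | size-dualNetwork C | size-permutationNetwork {n} reverse = +-identityʳ _
    D↑ : ∀ x → run D x ≡ negVec (run C (negVec x))
    D↑ x = trans (cong (run D) (sym (negVec-involutive x))) (run-dualNetwork C (negVec x))
    D++R↑ : Sorts (D ++ R) _
    D++R↑ x Xx rewrite run-++ D R x | D↑ x = Sorted-reverse-negVec (C↑ _ (X→Y x Xx))

  similar⇒noHarderToSort : {X Y : SetB n} → Similar X Y → NoHarderToSort X Y × NoHarderToSort Y X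
  similar⇒noHarderToSort (sim-eq (X⊆Y , Y⊆X)) = noHarderToSort-⊆ X⊆Y , noHarderToSort-⊆ Y⊆X
  similar⇒noHarderToSort {X} (sim-perm σ) =
    noHarderToSort-permVec σ (λ x Xx → x , Xx , refl) ,
    noHarderToSort-permVec (flip σ) λ { _ (x , Xx , refl) → subst X (sym (permVec-flip-permVec σ x)) Xx }
  similar⇒noHarderToSort {X} sim-neg =
    noHarderToSort-negVec (λ x Xx → x , Xx , refl) ,
    noHarderToSort-negVec λ { _ (x , Xx , refl) → subst X (sym (negVec-involutive x)) Xx }
  similar⇒noHarderToSort (sim-sym X∼Y) = let (≼ , ≽) = similar⇒noHarderToSort X∼Y in ≽ , ≼
  similar⇒noHarderToSort (sim-trans X∼Y Y∼Z) =
    let (X≼Y , Y≼X) = similar⇒noHarderToSort X∼Y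
        (Y≼Z , Z≼Y) = similar⇒noHarderToSort Y∼Z
    in noHarderToSort-trans X≼Y Y≼Z , noHarderToSort-trans Z≼Y Y≼X

  subsumes⇒noHarderToSort : {X Y : SetB n} → Subsumes X Y → NoHarderToSort X Y
  subsumes⇒noHarderToSort (sub-incl X⊆Y)      = noHarderToSort-⊆ X⊆Y
  subsumes⇒noHarderToSort (sub-sim X∼Y)       = proj₁ (similar⇒noHarderToSort X∼Y)
  subsumes⇒noHarderToSort (sub-trans X⊑Y Y⊑Z) =
    noHarderToSort-trans (subsumes⇒noHarderToSort X⊑Y) (subsumes⇒noHarderToSort Y⊑Z)

mainTheorem13 : ∀ (n : ℕ) (X Y : SetB n) (sX sY : ℕ) →
    Subsumes X Y → IsS X sX → IsS Y sY → sX ≤ sY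
mainTheorem13 n X Y sX sY X⊑Y (_ , sX-minimal) ((C , C↑ , size-C≡sY) , _)
  with subsumes⇒noHarderToSort X⊑Y C C↑
... | C′ , C′↑ , C′≤C = ≤-trans (sX-minimal C′ C′↑) (subst (size C′ ≤_) size-C≡sY C′≤C)
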